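{- Let $u$ and $v$ be well-formed suspension expressions with $u\rhd_{rm} v$ (respectively $u\rhd_{rm\beta_s}v$). If $u$ and $v$ are terms, there is a $\lambda\sigma$-term $w$ with $S(u)\to_\sigma^* w$ and $S(v)\to_\sigma^* w$ (respectively $S(u)\to_{\lambda\sigma}^* w$ and $S(v)\to_{\lambda\sigma}^* w$). If $u$ and $v$ are environments, then for any natural number $i$ with $lev(u)\le i$ there is a $\lambda\sigma$-substitution $w$ with $R(u,i)\to_\sigma^* w$ and $R(v,i)\to_\sigma^* w$ (respectively $R(u,i)\to_{\lambda\sigma}^* w$ and $R(v,i)\to_{\lambda\sigma}^* w$).
   Context: Suspension calculus (no constants, no meta variables): terms $t ::= \#i \mid (t\ t)\mid(\lambda\, t)\mid [\![t,n,n,e]\!]$, environments $e::= nil\mid ((t,n)::e)\mid \{\!\{e,n,n,e\}\!\}$ ($n$ naturals, $i$ positive integers). $m\mathbin{\dot- } n=\max(m-n,0)$. $len(nil)=0$, $len((t,l)::e)=1+len(e)$, $len(\{\!\{e_1,nl_1,ol_2,e_2\}\!\})=len(e_1)+(len(e_2)\mathbin{\dot- } nl_1)$; $lev(nil)=0$, $lev((t,l)::e)=l$, $lev(\{\!\{e_1,nl_1,ol_2,e_2\}\!\})=lev(e_2)+(nl_1\mathbin{\dot- } ol_2)$. Well-formed: every subexpression $[\![t,ol,nl,e]\!]$ has $len(e)=ol$, $lev(e)\le nl$; $(t,l)::e$ has $l\ge lev(e)$; $\{\!\{e_1,nl_1,ol_2,e_2\}\!\}$ has $lev(e_1)\le nl_1$,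 $len(e_2)=ol_2$. Rules: $(\beta_s)$ $((\lambda t_1)\ t_2)\to[\![t_1,1,0,(t_2,0)::nil]\!]$; (r2) $[\![\#i,0,nl,nil]\!]\to\#(i+nl)$; (r3) $[\![\#1,ol,nl,(t,l)::e]\!]\to[\![t,0,nl-l,nil]\!]$; (r4) $[\![\#i,ol,nl,(t,l)::e]\!]\to[\![\#(i-1),ol-1,nl,e]\!]$ if $i>1$; (r5) $[\![(t_1\ t_2),ol,nl,e]\!]\to([\![t_1,ol,nl,e]\!]\ [\![t_2,ol,nl,e]\!])$; (r6) $[\![(\lambda t),ol,nl,e]\!]\to(\lambda [\![t,ol+1,nl+1,(\#1,nl+1)::e]\!])$; (m1) $[\![[\![t,ol_1,nl_1,e_1]\!],ol_2,nl_2,e_2]\!]\to[\![t,ol_1+(ol_2\mathbin{\dot- } nl_1),nl_2+(nl_1\mathbin{\dot- } ol_2),\{\!\{e_1,nl_1,ol_2,e_2\}\!\}]\!]$; (m2) $\{\!\{e_1,nl_1,0,nil\}\!\}\to e_1$; (m3) $\{\!\{nil,0,ol_2,e_2\}\!\}\to e_2$; (m4) $\{\!\{nil,nl_1,ol_2,(t,l)::e_2\}\!\}\to\{\!\{nil,nl_1-1,ol_2-1,e_2\}\!\}$ if $nl_1\ge1$; (m5) $\{\!\{(t,n)::e_1,nl_1,ol_2,(s,l)::e_2\}\!\}\to\{\!\{(t,n)::e_1,nl_1-1,ol_2-1,e_2\}\!\}$ if $nl_1>n$; (m6) $\{\!\{(t,n)::e_1,n,ol_2,(s,l)::e_2\}\!\}\to([\![t,ol_2,l,(s,l)::e_2]\!],l+(n\mathbin{\dot-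 } ol_2))::\{\!\{e_1,n,ol_2,(s,l)::e_2\}\!\}$. $\rhd_{rm}$: one application of (r2)–(r6),(m1)–(m6) at a subexpression; $\rhd_{rm\beta_s}$: one application of any of these rules or $(\beta_s)$. $\lambda\sigma$-calculus: terms $a ::= 1\mid a\ b\mid\lambda a\mid a[s]$; substitutions $s ::= id\mid a\cdot s\mid s\circ t\mid \uparrow$. $\uparrow^0=id$, $\uparrow^1=\uparrow$, $\uparrow^{n+1}=\uparrow\circ\uparrow^n$. Rules: (Beta) $(\lambda a)\ b\to a[b\cdot id]$; (App) $(a\ b)[s]\to a[s]\ b[s]$; (Abs) $(\lambda a)[s]\to\lambda a[1\cdot(s\circ\uparrow)]$; (VarId) $1[id]\to 1$; (VarCons) $1[a\cdot s]\to a$; (Clos) $a[s][t]\to a[s\circ t]$; (Map) $(a\cdot s)\circ t\to a[t]\cdot(s\circ t)$; (Ass) $(s\circ t)\circ u\to s\circ(t\circ u)$; (IdL) $id\circ s\to s$; (ShiftId) $\uparrow\circ id\to\uparrow$; (ShiftCons) $\uparrow\circ(a\cdot s)\to s$. $\to_{\lambda\sigma}$: one application of any rule at a subexpression; $\to_\sigma$: one application of any rule except (Beta); $^*$ denotes reflexive–transitive closure. Translations: $S(\#1)=1$; $S(\#(n+1))=1[\uparrow^n]$ for $n>0$; $S(a\ b)=S(a)\ S(b)$; $S(\lambda a)=\lambda S(a)$; $S([\![t,ol,nl,e]\!])=S(t)[R(e,nl)]$. For an environment $e$ and natural $i$ with $lev(e)\le i$: $R(nil,i)=(\cdots((id\circ\uparrow)\circ\uparrow)\cdots)\circ\uparrow$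 with $i$ occurrences of $\uparrow$; $R((t,n)::e',i)=(\cdots(((S(t)\cdot R(e',n))\circ\uparrow)\circ\uparrow)\cdots)\circ\uparrow$ with $i-n$ occurrences of $\uparrow$; $R(\{\!\{e_1,nl_1,ol_2,e_2\}\!\},i)=R(e_1,nl_1)\circ R(e_2,i-(nl_1\mathbin{\dot- } ol_2))$. -}

module Defs where

open import Data.Nat using (ℕ; zero; suc; _+_; _∸_; _≤_; _<_; _≥_; _>_)
open import Data.Product using (Σ; _×_; _,_)
open import Relation.Binary.PropositionalEquality using (_≡_)
open import Relation.Binary.Construct.Closure.ReflexiveTransitive using (Star)

-- Suspension calculus (no constants, no meta variables)
-- Variables: `var k` stands for the de Bruijn index #(k+1)  (k : ℕ),
-- so that indices are exactly the positive integers.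

mutual
  data STerm : Set where
    var  : ℕ → STerm
    app  : STerm → STerm → STerm
    lam  : STerm → STerm
    susp : STerm → ℕ → ℕ → Env → STerm

  data Env : Set where
    nil  : Env
    cons : STerm → ℕ → Env → Env
    comp : Env → ℕ → ℕ → Env → Env

len : Env → ℕ
len nil = 0
len (cons t l e) = suc (len e)
len (comp e₁ nl₁ ol₂ e₂) = len e₁ + (len e₂ ∸ nl₁)

lev : Env → ℕ
lev nil = 0
lev (cons t l e) = l
lev (comp e₁ nl₁ ol₂ e₂) = lev e₂ + (nl₁ ∸ ol₂)

mutual
  data WFTerm : STerm → Set where
    wf-var  : ∀ k → WFTerm (var k)
    wf-app  : ∀ {t₁ t₂} → WFTerm t₁ → WFTerm t₂ → WFTerm (app t₁ t₂)
    wf-lam  : ∀ {t} → WFTerm t → WFTerm (lam t)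
    wf-susp : ∀ {t ol nl e} → WFTerm t → WFEnv e →
              len e ≡ ol → lev e ≤ nl → WFTerm (susp t ol nl e)

  data WFEnv : Env → Set where
    wf-nil  : WFEnv nil
    wf-cons : ∀ {t l e} → WFTerm t → WFEnv e → lev e ≤ l → WFEnv (cons t l e)
    wf-comp : ∀ {e₁ nl₁ ol₂ e₂} → WFEnv e₁ → WFEnv e₂ →
              lev e₁ ≤ nl₁ → len e₂ ≡ ol₂ → WFEnv (comp e₁ nl₁ ol₂ e₂)

data Mode : Set where
  rm rmβs : Mode

mutual
  data _⊢_▷t_ : Mode → STerm → STerm → Set where
    βs  : ∀ {t₁ t₂} → rmβs ⊢ app (lam t₁) t₂ ▷t susp t₁ 1 0 (cons t₂ 0 nil)
    r2  : ∀ {md k nl} → md ⊢ susp (var k) 0 nl nil ▷t var (k + nl)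
    r3  : ∀ {md ol nl t l e} →
          md ⊢ susp (var 0) ol nl (cons t l e) ▷t susp t 0 (nl ∸ l) nil
    r4  : ∀ {md k ol nl t l e} →
          md ⊢ susp (var (suc k)) ol nl (cons t l e) ▷t susp (var k) (ol ∸ 1) nl e
    r5  : ∀ {md t₁ t₂ ol nl e} →
          md ⊢ susp (app t₁ t₂) ol nl e ▷t app (susp t₁ ol nl e) (susp t₂ ol nl e)
    r6  : ∀ {md t ol nl e} →
          md ⊢ susp (lam t) ol nl e ▷t lam (susp t (suc ol) (suc nl) (cons (var 0) (suc nl) e))
    m1  : ∀ {md t ol₁ nl₁ e₁ ol₂ nl₂ e₂} →
          md ⊢ susp (susp t ol₁ nl₁ e₁) ol₂ nl₂ e₂ ▷t
               susp t (ol₁ + (ol₂ ∸ nl₁)) (nl₂ + (nl₁ ∸ ol₂)) (comp e₁ nl₁ ol₂ e₂)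
    app₁  : ∀ {md t t' u} → md ⊢ t ▷t t' → md ⊢ app t u ▷t app t' u
    app₂  : ∀ {md t u u'} → md ⊢ u ▷t u' → md ⊢ app t u ▷t app t u'
    lam₁  : ∀ {md t t'} → md ⊢ t ▷t t' → md ⊢ lam t ▷t lam t'
    susp₁ : ∀ {md t t' ol nl e} → md ⊢ t ▷t t' → md ⊢ susp t ol nl e ▷t susp t' ol nl e
    susp₂ : ∀ {md t ol nl e e'} → md ⊢ e ▷e e' → md ⊢ susp t ol nl e ▷t susp t ol nl e'

  data _⊢_▷e_ : Mode → Env → Env → Set where
    m2 : ∀ {md e₁ nl₁} → md ⊢ comp e₁ nl₁ 0 nil ▷e e₁
    m3 : ∀ {md ol₂ e₂} → md ⊢ comp nil 0 ol₂ e₂ ▷e e₂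
    m4 : ∀ {md nl₁ ol₂ t l e₂} → nl₁ ≥ 1 →
         md ⊢ comp nil nl₁ ol₂ (cons t l e₂) ▷e comp nil (nl₁ ∸ 1) (ol₂ ∸ 1) e₂
    m5 : ∀ {md t n e₁ nl₁ ol₂ s l e₂} → nl₁ > n →
         md ⊢ comp (cons t n e₁) nl₁ ol₂ (cons s l e₂) ▷e
              comp (cons t n e₁) (nl₁ ∸ 1) (ol₂ ∸ 1) e₂
    m6 : ∀ {md t n e₁ ol₂ s l e₂} →
         md ⊢ comp (cons t n e₁) n ol₂ (cons s l e₂) ▷e
              cons (susp t ol₂ l (cons s l e₂)) (l + (n ∸ ol₂)) (comp e₁ n ol₂ (cons s l e₂))
    cons₁ : ∀ {md t t' l e} → md ⊢ t ▷t t' → md ⊢ cons t l e ▷e cons t' l e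
    cons₂ : ∀ {md t l e e'} → md ⊢ e ▷e e' → md ⊢ cons t l e ▷e cons t l e'
    comp₁ : ∀ {md e₁ e₁' nl₁ ol₂ e₂} → md ⊢ e₁ ▷e e₁' →
            md ⊢ comp e₁ nl₁ ol₂ e₂ ▷e comp e₁' nl₁ ol₂ e₂
    comp₂ : ∀ {md e₁ nl₁ ol₂ e₂ e₂'} → md ⊢ e₂ ▷e e₂' →
            md ⊢ comp e₁ nl₁ ol₂ e₂ ▷e comp e₁ nl₁ ol₂ e₂'

infixl 30 _[_]
infixr 25 _·_
infixl 25 _∘_
infix 4 _⊢_⟶t_ _⊢_⟶s_ _⊢_⟶t*_ _⊢_⟶s*_ _⊢_▷t_ _⊢_▷e_

mutual
  data LTerm : Set where
    one  : LTerm
    app  : LTerm → LTerm → LTerm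
    lam  : LTerm → LTerm
    _[_] : LTerm → Subst → LTerm

  data Subst : Set where
    id   : Subst
    _·_  : LTerm → Subst → Subst
    _∘_  : Subst → Subst → Subst
    ↑    : Subst

-- one-step λσ reduction; the Mode flag says whether (Beta) is allowed:
-- rm ↦ →σ (no Beta),  rmβs ↦ →λσ (all rules)
mutual
  data _⊢_⟶t_ : Mode → LTerm → LTerm → Set where
    Beta    : ∀ {a b} → rmβs ⊢ app (lam a) b ⟶t (a [ b · id ])
    App     : ∀ {md a b s} → md ⊢ (app a b) [ s ] ⟶t app (a [ s ]) (b [ s ])
    Abs     : ∀ {md a s} → md ⊢ (lam a) [ s ] ⟶t lam (a [ one · (s ∘ ↑) ])
    VarId   : ∀ {md} → md ⊢ one [ id ] ⟶t one
    VarCons : ∀ {md a s} → md ⊢ one [ a · s ] ⟶t a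
    Clos    : ∀ {md a s t} → md ⊢ (a [ s ]) [ t ] ⟶t (a [ s ∘ t ])
    app₁ : ∀ {md a a' b} → md ⊢ a ⟶t a' → md ⊢ app a b ⟶t app a' b
    app₂ : ∀ {md a b b'} → md ⊢ b ⟶t b' → md ⊢ app a b ⟶t app a b'
    lam₁ : ∀ {md a a'} → md ⊢ a ⟶t a' → md ⊢ lam a ⟶t lam a'
    clo₁ : ∀ {md a a' s} → md ⊢ a ⟶t a' → md ⊢ a [ s ] ⟶t a' [ s ]
    clo₂ : ∀ {md a s s'} → md ⊢ s ⟶s s' → md ⊢ a [ s ] ⟶t a [ s' ]

  data _⊢_⟶s_ : Mode → Subst → Subst → Set where
    Map       : ∀ {md a s t} → md ⊢ (a · s) ∘ t ⟶s ((a [ t ]) · (s ∘ t))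
    Ass       : ∀ {md s t u} → md ⊢ (s ∘ t) ∘ u ⟶s (s ∘ (t ∘ u))
    IdL       : ∀ {md s} → md ⊢ id ∘ s ⟶s s
    ShiftId   : ∀ {md} → md ⊢ ↑ ∘ id ⟶s ↑
    ShiftCons : ∀ {md a s} → md ⊢ ↑ ∘ (a · s) ⟶s s
    cons₁ : ∀ {md a a' s} → md ⊢ a ⟶t a' → md ⊢ a · s ⟶s a' · s
    cons₂ : ∀ {md a s s'} → md ⊢ s ⟶s s' → md ⊢ a · s ⟶s a · s'
    comp₁ : ∀ {md s s' t} → md ⊢ s ⟶s s' → md ⊢ s ∘ t ⟶s s' ∘ t
    comp₂ : ∀ {md s t t'} → md ⊢ t ⟶s t' → md ⊢ s ∘ t ⟶s s ∘ t'

_⊢_⟶t*_ : Mode → LTerm → LTerm → Set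
md ⊢ a ⟶t* b = Star (md ⊢_⟶t_) a b

_⊢_⟶s*_ : Mode → Subst → Subst → Set
md ⊢ s ⟶s* t = Star (md ⊢_⟶s_) s t

↑^ : ℕ → Subst
↑^ zero = id
↑^ (suc zero) = ↑
↑^ (suc (suc n)) = ↑ ∘ ↑^ (suc n)

shifts : Subst → ℕ → Subst
shifts s zero = s
shifts s (suc k) = shifts s k ∘ ↑

mutual
  S : STerm → LTerm
  S (var zero) = one
  S (var (suc n)) = one [ ↑^ (suc n) ]
  S (app a b) = app (S a) (S b)
  S (lam a) = lam (S a)
  S (susp t ol nl e) = S t [ R e nl ]

  -- R e i is only meaningful when lev e ≤ i (then all subtractions are exact)
  R : Env → ℕ → Subst
  R nil i = shifts id i
  R (cons t n e') i = shifts (S t · R e' n) (i ∸ n)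
  R (comp e₁ nl₁ ol₂ e₂) i = R e₁ nl₁ ∘ R e₂ (i ∸ (nl₁ ∸ ol₂))

-- Every λσ-term σ-reduces, without (Beta), to the embedding of its σ-normal form: a pure
-- de Bruijn term, on which a normal substitution p₁ · … · pₖ · ↑ⁿ acts by ordinary parallel
-- substitution. Hence two λσ-expressions are σ-joinable as soon as their normal forms agree.
-- For a well-formed suspension expression, each rule (r2)–(r6), (m1)–(m6) leaves the normal form
-- of the translation unchanged (well-formedness makes the truncated subtractions in R exact),
-- (β_s) is simulated by a single (Beta) step, and congruence steps lift through contexts.
module Submission where

open import Defs
open import Data.Nat using (ℕ; zero; suc; _+_; _∸_; _≤_; z≤n; s≤s)
open import Data.Nat.Properties
  using (+-comm; +-assoc; +-suc; +-identityʳ; n∸n≡0; 0∸n≡0; +-∸-comm; +-∸-assoc; ∸-+-assoc;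
         m+n∸n≡m; m+[n∸m]≡n; m+n≤o⇒m≤o∸n; m+n≤o⇒n≤o; ≤-refl)
open import Data.Product using (Σ; _×_; _,_)
open import Relation.Binary.PropositionalEquality
  using (_≡_; refl; sym; trans; cong; cong₂; _≗_; module ≡-Reasoning)
open import Relation.Binary.Construct.Closure.ReflexiveTransitive using (Star; ε; _◅_; _◅◅_; gmap)
open import Relation.Binary.Construct.Closure.ReflexiveTransitive.Properties using (reflexive)

open ≡-Reasoning

data Tm : Set where
  #_  : ℕ → Tm
  _$_ : Tm → Tm → Tm
  ƛ_  : Tm → Tm

ext : (ℕ → ℕ) → ℕ → ℕ
ext ρ zero = zero
ext ρ (suc i) = suc (ρ i)

rename : (ℕ → ℕ) → Tm → Tm
rename ρ (# i) = # ρ i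
rename ρ (p $ q) = rename ρ p $ rename ρ q
rename ρ (ƛ p) = ƛ rename (ext ρ) p

exts : (ℕ → Tm) → ℕ → Tm
exts f zero = # 0
exts f (suc i) = rename suc (f i)

subst : (ℕ → Tm) → Tm → Tm
subst f (# i) = f i
subst f (p $ q) = subst f p $ subst f q
subst f (ƛ p) = ƛ subst (exts f) p

ext-cong : ∀ {ρ ρ′} → ρ ≗ ρ′ → ext ρ ≗ ext ρ′
ext-cong h zero = refl
ext-cong h (suc i) = cong suc (h i)

rename-cong : ∀ {ρ ρ′} → ρ ≗ ρ′ → rename ρ ≗ rename ρ′
rename-cong h (# i) = cong #_ (h i)
rename-cong h (p $ q) = cong₂ _$_ (rename-cong h p) (rename-cong h q)
rename-cong h (ƛ p) = cong ƛ_ (rename-cong (ext-cong h) p)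

exts-cong : ∀ {f g} → f ≗ g → exts f ≗ exts g
exts-cong h zero = refl
exts-cong h (suc i) = cong (rename suc) (h i)

subst-cong : ∀ {f g} → f ≗ g → subst f ≗ subst g
subst-cong h (# i) = h i
subst-cong h (p $ q) = cong₂ _$_ (subst-cong h p) (subst-cong h q)
subst-cong h (ƛ p) = cong ƛ_ (subst-cong (exts-cong h) p)

rename-rename : ∀ ρ ρ′ p → rename ρ (rename ρ′ p) ≡ rename (λ i → ρ (ρ′ i)) p
rename-rename ρ ρ′ (# i) = refl
rename-rename ρ ρ′ (p $ q) = cong₂ _$_ (rename-rename ρ ρ′ p) (rename-rename ρ ρ′ q)
rename-rename ρ ρ′ (ƛ p) = cong ƛ_ (trans (rename-rename (ext ρ) (ext ρ′) p)
  (rename-cong (λ { zero → refl ; (suc i) → refl }) p))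

rename-id : ∀ p → rename (λ i → i) p ≡ p
rename-id (# i) = refl
rename-id (p $ q) = cong₂ _$_ (rename-id p) (rename-id q)
rename-id (ƛ p) = cong ƛ_ (trans (rename-cong (λ { zero → refl ; (suc i) → refl }) p) (rename-id p))

subst-rename : ∀ f ρ p → subst f (rename ρ p) ≡ subst (λ i → f (ρ i)) p
subst-rename f ρ (# i) = refl
subst-rename f ρ (p $ q) = cong₂ _$_ (subst-rename f ρ p) (subst-rename f ρ q)
subst-rename f ρ (ƛ p) = cong ƛ_ (trans (subst-rename (exts f) (ext ρ) p)
  (subst-cong (λ { zero → refl ; (suc i) → refl }) p))

rename-subst : ∀ ρ f p → rename ρ (subst f p) ≡ subst (λ i → rename ρ (f i)) p
rename-subst ρ f (# i) = refl
rename-subst ρ f (p $ q) = cong₂ _$_ (rename-subst ρ f p) (rename-subst ρ f q)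
rename-subst ρ f (ƛ p) = cong ƛ_ (trans (rename-subst (ext ρ) (exts f) p)
  (subst-cong (λ { zero → refl
                 ; (suc i) → trans (rename-rename (ext ρ) suc (f i)) (sym (rename-rename suc ρ (f i))) }) p))

subst-subst : ∀ g f p → subst g (subst f p) ≡ subst (λ i → subst g (f i)) p
subst-subst g f (# i) = refl
subst-subst g f (p $ q) = cong₂ _$_ (subst-subst g f p) (subst-subst g f q)
subst-subst g f (ƛ p) = cong ƛ_ (trans (subst-subst (exts g) (exts f) p)
  (subst-cong (λ { zero → refl
                 ; (suc i) → trans (subst-rename (exts g) suc (f i)) (sym (rename-subst suc g (f i))) }) p))

subst-var : ∀ ρ p → subst (λ i → # ρ i) p ≡ rename ρ p
subst-var ρ (# i) = refl
subst-var ρ (p $ q) = cong₂ _$_ (subst-var ρ p) (subst-var ρ q)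
subst-var ρ (ƛ p) = cong ƛ_ (trans (subst-cong (λ { zero → refl ; (suc i) → refl }) p) (subst-var (ext ρ) p))

-- p₁ ∷ … ∷ pₖ ∷ ↑ⁿ n stands for p₁ · … · pₖ · ↑ⁿ, the σ-normal shape of a substitution.
infixr 5 _∷_
data NSub : Set where
  ↑ⁿ  : ℕ → NSub
  _∷_ : Tm → NSub → NSub

lookup : NSub → ℕ → Tm
lookup (↑ⁿ m) i = # (i + m)
lookup (p ∷ σ) zero = p
lookup (p ∷ σ) (suc i) = lookup σ i

infixl 8 _⟦_⟧
_⟦_⟧ : Tm → NSub → Tm
p ⟦ σ ⟧ = subst (lookup σ) p

drop : ℕ → NSub → NSub
drop n (↑ⁿ m) = ↑ⁿ (n + m)
drop zero (p ∷ σ) = p ∷ σ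
drop (suc n) (p ∷ σ) = drop n σ

infixr 7 _⊚_
_⊚_ : NSub → NSub → NSub
↑ⁿ n ⊚ τ = drop n τ
(p ∷ σ) ⊚ τ = p ⟦ τ ⟧ ∷ σ ⊚ τ

lift : NSub → NSub
lift σ = # 0 ∷ σ ⊚ ↑ⁿ 1

lookup-drop : ∀ n τ i → lookup (drop n τ) i ≡ lookup τ (i + n)
lookup-drop n (↑ⁿ m) i = cong #_ (sym (+-assoc i n m))
lookup-drop zero (p ∷ τ) i = cong (lookup (p ∷ τ)) (sym (+-identityʳ i))
lookup-drop (suc n) (p ∷ τ) i = trans (lookup-drop n τ i) (cong (lookup (p ∷ τ)) (sym (+-suc i n)))

lookup-⊚ : ∀ σ τ i → lookup (σ ⊚ τ) i ≡ lookup σ i ⟦ τ ⟧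
lookup-⊚ (↑ⁿ n) τ i = lookup-drop n τ i
lookup-⊚ (p ∷ σ) τ zero = refl
lookup-⊚ (p ∷ σ) τ (suc i) = lookup-⊚ σ τ i

⟦⟧-⊚ : ∀ p σ τ → p ⟦ σ ⟧ ⟦ τ ⟧ ≡ p ⟦ σ ⊚ τ ⟧
⟦⟧-⊚ p σ τ = trans (subst-subst (lookup τ) (lookup σ) p) (subst-cong (λ i → sym (lookup-⊚ σ τ i)) p)

⟦↑ⁿ1⟧ : ∀ p → p ⟦ ↑ⁿ 1 ⟧ ≡ rename suc p
⟦↑ⁿ1⟧ p = trans (subst-cong (λ i → cong #_ (+-comm i 1)) p) (subst-var suc p)

⟦↑ⁿ0⟧ : ∀ p → p ⟦ ↑ⁿ 0 ⟧ ≡ p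
⟦↑ⁿ0⟧ p = trans (subst-cong (λ i → cong #_ (+-identityʳ i)) p) (trans (subst-var (λ i → i) p) (rename-id p))

lookup-lift : ∀ σ → lookup (lift σ) ≗ exts (lookup σ)
lookup-lift σ zero = refl
lookup-lift σ (suc i) = trans (lookup-⊚ σ (↑ⁿ 1) i) (⟦↑ⁿ1⟧ (lookup σ i))

ƛ-⟦⟧ : ∀ p σ → (ƛ p) ⟦ σ ⟧ ≡ ƛ (p ⟦ lift σ ⟧)
ƛ-⟦⟧ p σ = cong ƛ_ (sym (subst-cong (lookup-lift σ) p))

drop-zero : ∀ τ → drop 0 τ ≡ τ
drop-zero (↑ⁿ m) = refl
drop-zero (p ∷ τ) = refl

drop-drop : ∀ m n τ → drop m (drop n τ) ≡ drop (m + n) τ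
drop-drop m n (↑ⁿ k) = cong ↑ⁿ (sym (+-assoc m n k))
drop-drop m zero (p ∷ τ) = cong (λ k → drop k (p ∷ τ)) (sym (+-identityʳ m))
drop-drop m (suc n) (p ∷ τ) = trans (drop-drop m n τ) (cong (λ k → drop k (p ∷ τ)) (sym (+-suc m n)))

drop-⊚ : ∀ n σ τ → drop n (σ ⊚ τ) ≡ drop n σ ⊚ τ
drop-⊚ n (↑ⁿ m) τ = drop-drop n m τ
drop-⊚ zero (p ∷ σ) τ = refl
drop-⊚ (suc n) (p ∷ σ) τ = drop-⊚ n σ τ

⊚-assoc : ∀ σ τ υ → (σ ⊚ τ) ⊚ υ ≡ σ ⊚ (τ ⊚ υ)
⊚-assoc (↑ⁿ n) τ υ = sym (drop-⊚ n τ υ)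
⊚-assoc (p ∷ σ) τ υ = cong₂ _∷_ (⟦⟧-⊚ p τ υ) (⊚-assoc σ τ υ)

⊚-identityʳ : ∀ σ → σ ⊚ ↑ⁿ 0 ≡ σ
⊚-identityʳ (↑ⁿ n) = cong ↑ⁿ (+-identityʳ n)
⊚-identityʳ (p ∷ σ) = cong₂ _∷_ (⟦↑ⁿ0⟧ p) (⊚-identityʳ σ)

⌜_⌝ : Tm → LTerm
⌜ # zero ⌝ = one
⌜ # suc n ⌝ = one [ ↑^ (suc n) ]
⌜ p $ q ⌝ = app ⌜ p ⌝ ⌜ q ⌝
⌜ ƛ p ⌝ = lam ⌜ p ⌝

⌜_⌝ˢ : NSub → Subst
⌜ ↑ⁿ n ⌝ˢ = ↑^ n
⌜ p ∷ σ ⌝ˢ = ⌜ p ⌝ · ⌜ σ ⌝ˢ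

mutual
  nf : LTerm → Tm
  nf one = # 0
  nf (app a b) = nf a $ nf b
  nf (lam a) = ƛ nf a
  nf (a [ s ]) = nf a ⟦ nfˢ s ⟧

  nfˢ : Subst → NSub
  nfˢ id = ↑ⁿ 0
  nfˢ (a · s) = nf a ∷ nfˢ s
  nfˢ (s ∘ t) = nfˢ s ⊚ nfˢ t
  nfˢ ↑ = ↑ⁿ 1

↑^-+ : ∀ {md} m n → md ⊢ ↑^ m ∘ ↑^ n ⟶s* ↑^ (m + n)
↑^-+ zero n = IdL ◅ ε
↑^-+ (suc zero) zero = ShiftId ◅ ε
↑^-+ (suc zero) (suc n) = ε
↑^-+ (suc (suc m)) n = Ass ◅ gmap (↑ ∘_) comp₂ (↑^-+ (suc m) n)

↑-∘ : ∀ {md} τ → md ⊢ ↑ ∘ ⌜ τ ⌝ˢ ⟶s* ⌜ drop 1 τ ⌝ˢ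
↑-∘ (↑ⁿ m) = ↑^-+ 1 m
↑-∘ (p ∷ τ) = ShiftCons ◅ reflexive _ (cong ⌜_⌝ˢ (sym (drop-zero τ)))

↑^-∘ : ∀ {md} n τ → md ⊢ ↑^ n ∘ ⌜ τ ⌝ˢ ⟶s* ⌜ drop n τ ⌝ˢ
↑^-∘ zero τ = IdL ◅ reflexive _ (cong ⌜_⌝ˢ (sym (drop-zero τ)))
↑^-∘ (suc zero) τ = ↑-∘ τ
↑^-∘ (suc (suc n)) τ =
  Ass ◅ gmap (↑ ∘_) comp₂ (↑^-∘ (suc n) τ) ◅◅ ↑-∘ (drop (suc n) τ) ◅◅
  reflexive _ (cong ⌜_⌝ˢ (drop-drop 1 (suc n) τ))

ClosureReduces : Mode → NSub → Tm → Set
ClosureReduces md σ p = md ⊢ ⌜ p ⌝ [ ⌜ σ ⌝ˢ ] ⟶t* ⌜ p ⟦ σ ⟧ ⌝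

one-closure : ∀ {md} τ → md ⊢ one [ ⌜ τ ⌝ˢ ] ⟶t* ⌜ lookup τ 0 ⌝
one-closure (↑ⁿ zero) = VarId ◅ ε
one-closure (↑ⁿ (suc m)) = ε
one-closure (p ∷ τ) = VarCons ◅ ε

var-closure : ∀ {md} i τ → ClosureReduces md τ (# i)
var-closure zero τ = one-closure τ
var-closure (suc i) τ =
  Clos ◅ gmap (one [_]) clo₂ (↑^-∘ (suc i) τ) ◅◅ one-closure (drop (suc i) τ) ◅◅
  reflexive _ (cong ⌜_⌝ (lookup-drop (suc i) τ 0))

app-closure : ∀ {md} σ {p q} → ClosureReduces md σ p → ClosureReduces md σ q → ClosureReduces md σ (p $ q)
app-closure σ {p} {q} hp hq =
  App ◅ gmap (λ a → app a (⌜ q ⌝ [ ⌜ σ ⌝ˢ ])) app₁ hp ◅◅ gmap (app ⌜ p ⟦ σ ⟧ ⌝) app₂ hq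

lam-closure : ∀ {md} σ {p} → md ⊢ ⌜ σ ⌝ˢ ∘ ↑ ⟶s* ⌜ σ ⊚ ↑ⁿ 1 ⌝ˢ → ClosureReduces md (lift σ) p →
              ClosureReduces md σ (ƛ p)
lam-closure σ {p} hσ hp =
  Abs ◅ gmap (λ s → lam (⌜ p ⌝ [ one · s ])) (λ r → lam₁ (clo₂ (cons₂ r))) hσ ◅◅
  gmap lam lam₁ hp ◅◅ reflexive _ (cong ⌜_⌝ (sym (ƛ-⟦⟧ p σ)))

data AllEntries (P : Tm → Set) : NSub → Set where
  ↑ⁿ  : ∀ n → AllEntries P (↑ⁿ n)
  _∷_ : ∀ {p σ} → P p → AllEntries P σ → AllEntries P (p ∷ σ)

allEntries : ∀ {P} → (∀ p → P p) → ∀ σ → AllEntries P σ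
allEntries f (↑ⁿ n) = ↑ⁿ n
allEntries f (p ∷ σ) = f p ∷ allEntries f σ

mapEntries : ∀ {P Q} → (∀ {p} → P p → Q p) → ∀ {σ} → AllEntries P σ → AllEntries Q σ
mapEntries f (↑ⁿ n) = ↑ⁿ n
mapEntries f (h ∷ hs) = f h ∷ mapEntries f hs

⊚-reduces : ∀ {md σ τ} → AllEntries (ClosureReduces md τ) σ → md ⊢ ⌜ σ ⌝ˢ ∘ ⌜ τ ⌝ˢ ⟶s* ⌜ σ ⊚ τ ⌝ˢ
⊚-reduces {τ = τ} (↑ⁿ n) = ↑^-∘ n τ
⊚-reduces {σ = p ∷ σ} {τ} (h ∷ hs) =
  Map ◅ gmap (λ a → a · (⌜ σ ⌝ˢ ∘ ⌜ τ ⌝ˢ)) cons₁ h ◅◅ gmap (⌜ p ⟦ τ ⟧ ⌝ ·_) cons₂ (⊚-reduces hs)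

data IsVar : Tm → Set where
  isVar : ∀ i → IsVar (# i)

IsRenaming : NSub → Set
IsRenaming = AllEntries IsVar

renaming-⊚↑ : ∀ {ρ} → IsRenaming ρ → IsRenaming (ρ ⊚ ↑ⁿ 1)
renaming-⊚↑ (↑ⁿ n) = ↑ⁿ (n + 1)
renaming-⊚↑ (isVar i ∷ hs) = isVar (i + 1) ∷ renaming-⊚↑ hs

-- Going under λ needs ⌜ σ ⌝ˢ ∘ ↑ ⟶ ⌜ σ ⊚ ↑ⁿ 1 ⌝ˢ, i.e. the closure lemma for the entries of σ
-- under ↑. For a renaming the entries are variables, which breaks the circularity.
renaming-closure : ∀ {md ρ} → IsRenaming ρ → ∀ p → ClosureReduces md ρ p
renaming-closure {ρ = ρ} hρ (# i) = var-closure i ρ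
renaming-closure {ρ = ρ} hρ (p $ q) = app-closure ρ (renaming-closure hρ p) (renaming-closure hρ q)
renaming-closure {ρ = ρ} hρ (ƛ p) =
  lam-closure ρ (⊚-reduces (mapEntries (λ { (isVar i) → var-closure i (↑ⁿ 1) }) hρ))
              (renaming-closure (isVar 0 ∷ renaming-⊚↑ hρ) p)

closure-reduces : ∀ {md} σ p → ClosureReduces md σ p
closure-reduces σ (# i) = var-closure i σ
closure-reduces σ (p $ q) = app-closure σ (closure-reduces σ p) (closure-reduces σ q)
closure-reduces σ (ƛ p) =
  lam-closure σ (⊚-reduces (allEntries (renaming-closure (↑ⁿ 1)) σ)) (closure-reduces (lift σ) p)

mutual
  reduces-to-nf : ∀ {md} a → md ⊢ a ⟶t* ⌜ nf a ⌝
  reduces-to-nf one = ε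
  reduces-to-nf (app a b) =
    gmap (λ x → app x b) app₁ (reduces-to-nf a) ◅◅ gmap (app ⌜ nf a ⌝) app₂ (reduces-to-nf b)
  reduces-to-nf (lam a) = gmap lam lam₁ (reduces-to-nf a)
  reduces-to-nf (a [ s ]) =
    gmap (_[ s ]) clo₁ (reduces-to-nf a) ◅◅ gmap (⌜ nf a ⌝ [_]) clo₂ (reducesˢ-to-nf s) ◅◅
    closure-reduces (nfˢ s) (nf a)

  reducesˢ-to-nf : ∀ {md} s → md ⊢ s ⟶s* ⌜ nfˢ s ⌝ˢ
  reducesˢ-to-nf id = ε
  reducesˢ-to-nf (a · s) =
    gmap (_· s) cons₁ (reduces-to-nf a) ◅◅ gmap (⌜ nf a ⌝ ·_) cons₂ (reducesˢ-to-nf s)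
  reducesˢ-to-nf (s ∘ t) =
    gmap (_∘ t) comp₁ (reducesˢ-to-nf s) ◅◅ gmap (⌜ nfˢ s ⌝ˢ ∘_) comp₂ (reducesˢ-to-nf t) ◅◅
    ⊚-reduces (allEntries (closure-reduces (nfˢ t)) (nfˢ s))
  reducesˢ-to-nf ↑ = ε

Joinable : {A : Set} → (A → A → Set) → A → A → Set
Joinable _⟶_ a b = Σ _ (λ w → Star _⟶_ a w × Star _⟶_ b w)

step-joinable : ∀ {A : Set} {_⟶_ : A → A → Set} {a b} → a ⟶ b → Joinable _⟶_ a b
step-joinable {b = b} r = b , r ◅ ε , ε

joinable-map : ∀ {A B : Set} {_⟶_ : A → A → Set} {_⇒_ : B → B → Set} {a b} (f : A → B) →
               (∀ {x y} → x ⟶ y → f x ⇒ f y) → Joinable _⟶_ a b → Joinable _⇒_ (f a) (f b)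
joinable-map f g (w , p , q) = f w , gmap f g p , gmap f g q

nf-joinable : ∀ {md} a b → nf a ≡ nf b → Joinable (md ⊢_⟶t_) a b
nf-joinable a b eq = ⌜ nf b ⌝ , reduces-to-nf a ◅◅ reflexive _ (cong ⌜_⌝ eq) , reduces-to-nf b

nfˢ-joinable : ∀ {md} s t → nfˢ s ≡ nfˢ t → Joinable (md ⊢_⟶s_) s t
nfˢ-joinable s t eq = ⌜ nfˢ t ⌝ˢ , reducesˢ-to-nf s ◅◅ reflexive _ (cong ⌜_⌝ˢ eq) , reducesˢ-to-nf t

nf-⌜⌝ : ∀ p → nf ⌜ p ⌝ ≡ p
nf-⌜⌝ (# zero) = refl
nf-⌜⌝ (# suc n) = cong (λ σ → lookup σ 0) (nfˢ-↑^ (suc n))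
  where
  nfˢ-↑^ : ∀ n → nfˢ (↑^ n) ≡ ↑ⁿ n
  nfˢ-↑^ zero = refl
  nfˢ-↑^ (suc zero) = refl
  nfˢ-↑^ (suc (suc n)) = cong (drop 1) (nfˢ-↑^ (suc n))
nf-⌜⌝ (p $ q) = cong₂ _$_ (nf-⌜⌝ p) (nf-⌜⌝ q)
nf-⌜⌝ (ƛ p) = cong ƛ_ (nf-⌜⌝ p)

nf-S-var : ∀ k → nf (S (var k)) ≡ # k
nf-S-var zero = refl
nf-S-var (suc k) = nf-⌜⌝ (# suc k)

nfˢ-shifts : ∀ s k → nfˢ (shifts s k) ≡ nfˢ s ⊚ ↑ⁿ k
nfˢ-shifts s zero = sym (⊚-identityʳ (nfˢ s))
nfˢ-shifts s (suc k) = begin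
  nfˢ (shifts s k) ⊚ ↑ⁿ 1  ≡⟨ cong (_⊚ ↑ⁿ 1) (nfˢ-shifts s k) ⟩
  (nfˢ s ⊚ ↑ⁿ k) ⊚ ↑ⁿ 1    ≡⟨ ⊚-assoc (nfˢ s) (↑ⁿ k) (↑ⁿ 1) ⟩
  nfˢ s ⊚ ↑ⁿ (k + 1)       ≡⟨ cong (λ n → nfˢ s ⊚ ↑ⁿ n) (+-comm k 1) ⟩
  nfˢ s ⊚ ↑ⁿ (suc k)       ∎

nfˢ-R-nil : ∀ i → nfˢ (R nil i) ≡ ↑ⁿ i
nfˢ-R-nil i = nfˢ-shifts id i

nfˢ-R-cons : ∀ t n e i → nfˢ (R (cons t n e) i) ≡ (nf (S t) ∷ nfˢ (R e n)) ⊚ ↑ⁿ (i ∸ n)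
nfˢ-R-cons t n e i = nfˢ-shifts (S t · R e n) (i ∸ n)

nfˢ-R-+ : ∀ e {i} k → lev e ≤ i → nfˢ (R e (i + k)) ≡ nfˢ (R e i) ⊚ ↑ⁿ k
nfˢ-R-+ nil {i} k _ = trans (nfˢ-R-nil (i + k)) (cong (_⊚ ↑ⁿ k) (sym (nfˢ-R-nil i)))
nfˢ-R-+ (cons t n e) {i} k n≤i = begin
  nfˢ (R (cons t n e) (i + k))  ≡⟨ nfˢ-R-cons t n e (i + k) ⟩
  σ ⊚ ↑ⁿ (i + k ∸ n)            ≡⟨ cong (λ m → σ ⊚ ↑ⁿ m) (+-∸-comm k n≤i) ⟩
  σ ⊚ ↑ⁿ (i ∸ n + k)            ≡⟨ sym (⊚-assoc σ (↑ⁿ (i ∸ n)) (↑ⁿ k)) ⟩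
  (σ ⊚ ↑ⁿ (i ∸ n)) ⊚ ↑ⁿ k       ≡⟨ cong (_⊚ ↑ⁿ k) (sym (nfˢ-R-cons t n e i)) ⟩
  nfˢ (R (cons t n e) i) ⊚ ↑ⁿ k ∎
  where σ = nf (S t) ∷ nfˢ (R e n)
nfˢ-R-+ (comp e₁ nl₁ ol₂ e₂) {i} k h = begin
  σ ⊚ nfˢ (R e₂ (i + k ∸ d))      ≡⟨ cong (λ m → σ ⊚ nfˢ (R e₂ m)) (+-∸-comm k (m+n≤o⇒n≤o (lev e₂) h)) ⟩
  σ ⊚ nfˢ (R e₂ (i ∸ d + k))      ≡⟨ cong (σ ⊚_) (nfˢ-R-+ e₂ k (m+n≤o⇒m≤o∸n (lev e₂) h)) ⟩
  σ ⊚ (nfˢ (R e₂ (i ∸ d)) ⊚ ↑ⁿ k) ≡⟨ sym (⊚-assoc σ _ (↑ⁿ k)) ⟩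
  (σ ⊚ nfˢ (R e₂ (i ∸ d))) ⊚ ↑ⁿ k ∎
  where σ = nfˢ (R e₁ nl₁)
        d = nl₁ ∸ ol₂

nfˢ-R-weaken : ∀ e {i j} → lev e ≤ i → i ≤ j → nfˢ (R e j) ≡ nfˢ (R e i) ⊚ ↑ⁿ (j ∸ i)
nfˢ-R-weaken e {i} {j} h i≤j = trans (cong (λ m → nfˢ (R e m)) (sym (m+[n∸m]≡n i≤j))) (nfˢ-R-+ e (j ∸ i) h)

r2-nf : ∀ k nl → nf (S (susp (var k) 0 nl nil)) ≡ nf (S (var (k + nl)))
r2-nf k nl = trans (cong₂ _⟦_⟧ (nf-S-var k) (nfˢ-R-nil nl)) (sym (nf-S-var (k + nl)))

r3-nf : ∀ ol nl t l e → nf (S (susp (var 0) ol nl (cons t l e))) ≡ nf (S (susp t 0 (nl ∸ l) nil))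
r3-nf ol nl t l e = begin
  lookup (nfˢ (R (cons t l e) nl)) 0 ≡⟨ cong (λ σ → lookup σ 0) (nfˢ-R-cons t l e nl) ⟩
  nf (S t) ⟦ ↑ⁿ (nl ∸ l) ⟧            ≡⟨ cong (nf (S t) ⟦_⟧) (sym (nfˢ-R-nil (nl ∸ l))) ⟩
  nf (S t) ⟦ nfˢ (R nil (nl ∸ l)) ⟧   ∎

r4-nf : ∀ k ol nl t l e → lev e ≤ l → l ≤ nl →
        nf (S (susp (var (suc k)) ol nl (cons t l e))) ≡ nf (S (susp (var k) (ol ∸ 1) nl e))
r4-nf k ol nl t l e hₑ hₗ = begin
  nf (S (var (suc k))) ⟦ nfˢ (R (cons t l e) nl) ⟧
    ≡⟨ cong₂ _⟦_⟧ (nf-S-var (suc k)) (nfˢ-R-cons t l e nl) ⟩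
  lookup (nfˢ (R e l) ⊚ ↑ⁿ (nl ∸ l)) k
    ≡⟨ cong (λ σ → lookup σ k) (sym (nfˢ-R-weaken e hₑ hₗ)) ⟩
  lookup (nfˢ (R e nl)) k
    ≡⟨ cong (_⟦ nfˢ (R e nl) ⟧) (sym (nf-S-var k)) ⟩
  nf (S (var k)) ⟦ nfˢ (R e nl) ⟧ ∎

nfˢ-R-lift : ∀ e nl → lev e ≤ nl → nfˢ (R (cons (var 0) (suc nl) e) (suc nl)) ≡ lift (nfˢ (R e nl))
nfˢ-R-lift e nl hₑ = begin
  nfˢ (R (cons (var 0) (suc nl) e) (suc nl)) ≡⟨ nfˢ-R-cons (var 0) (suc nl) e (suc nl) ⟩
  σ ⊚ ↑ⁿ (nl ∸ nl)                           ≡⟨ cong (λ n → σ ⊚ ↑ⁿ n) (n∸n≡0 nl) ⟩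
  σ ⊚ ↑ⁿ 0                                   ≡⟨ ⊚-identityʳ σ ⟩
  # 0 ∷ nfˢ (R e (suc nl))                   ≡⟨ cong (λ m → # 0 ∷ nfˢ (R e m)) (+-comm 1 nl) ⟩
  # 0 ∷ nfˢ (R e (nl + 1))                   ≡⟨ cong (# 0 ∷_) (nfˢ-R-+ e 1 hₑ) ⟩
  lift (nfˢ (R e nl))                        ∎
  where σ = # 0 ∷ nfˢ (R e (suc nl))

r6-nf : ∀ t ol nl e → lev e ≤ nl →
        nf (S (susp (lam t) ol nl e)) ≡ nf (S (lam (susp t (suc ol) (suc nl) (cons (var 0) (suc nl) e))))
r6-nf t ol nl e hₑ =
  trans (ƛ-⟦⟧ (nf (S t)) (nfˢ (R e nl))) (cong (λ σ → ƛ (nf (S t) ⟦ σ ⟧)) (sym (nfˢ-R-lift e nl hₑ)))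

m1-nf : ∀ t ol₁ nl₁ e₁ ol₂ nl₂ e₂ →
        nf (S (susp (susp t ol₁ nl₁ e₁) ol₂ nl₂ e₂)) ≡
        nf (S (susp t (ol₁ + (ol₂ ∸ nl₁)) (nl₂ + (nl₁ ∸ ol₂)) (comp e₁ nl₁ ol₂ e₂)))
m1-nf t ol₁ nl₁ e₁ ol₂ nl₂ e₂ =
  trans (⟦⟧-⊚ (nf (S t)) (nfˢ (R e₁ nl₁)) (nfˢ (R e₂ nl₂)))
        (cong (λ m → nf (S t) ⟦ nfˢ (R e₁ nl₁) ⊚ nfˢ (R e₂ m) ⟧) (sym (m+n∸n≡m nl₂ (nl₁ ∸ ol₂))))

m2-nf : ∀ e₁ nl₁ i → lev e₁ ≤ nl₁ → nl₁ ≤ i → nfˢ (R (comp e₁ nl₁ 0 nil) i) ≡ nfˢ (R e₁ i)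
m2-nf e₁ nl₁ i h₁ h =
  trans (cong (nfˢ (R e₁ nl₁) ⊚_) (nfˢ-R-nil (i ∸ nl₁))) (sym (nfˢ-R-weaken e₁ h₁ h))

m3-nf : ∀ ol₂ e₂ i → nfˢ (R (comp nil 0 ol₂ e₂) i) ≡ nfˢ (R e₂ i)
m3-nf ol₂ e₂ i = trans (drop-zero _) (cong (λ m → nfˢ (R e₂ (i ∸ m))) (0∸n≡0 ol₂))

m4-nf : ∀ n t l e₂ i → lev e₂ ≤ l → l + (n ∸ len e₂) ≤ i →
        nfˢ (R (comp nil (suc n) (suc (len e₂)) (cons t l e₂)) i) ≡ nfˢ (R (comp nil n (len e₂) e₂) i)
m4-nf n t l e₂ i hₑ h = begin
  nfˢ (R nil (suc n)) ⊚ nfˢ (R (cons t l e₂) j)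
    ≡⟨ cong₂ _⊚_ (nfˢ-R-nil (suc n)) (nfˢ-R-cons t l e₂ j) ⟩
  drop n (nfˢ (R e₂ l) ⊚ ↑ⁿ (j ∸ l))
    ≡⟨ cong (drop n) (sym (nfˢ-R-weaken e₂ hₑ (m+n≤o⇒m≤o∸n l h))) ⟩
  drop n (nfˢ (R e₂ j))
    ≡⟨ cong (_⊚ nfˢ (R e₂ j)) (sym (nfˢ-R-nil n)) ⟩
  nfˢ (R nil n) ⊚ nfˢ (R e₂ j) ∎
  where j = i ∸ (n ∸ len e₂)

m5-nf : ∀ t n e₁ nl s l e₂ i → n ≤ nl → lev e₂ ≤ l → l + (nl ∸ len e₂) ≤ i →
        nfˢ (R (comp (cons t n e₁) (suc nl) (suc (len e₂)) (cons s l e₂)) i) ≡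
        nfˢ (R (comp (cons t n e₁) nl (len e₂) e₂) i)
m5-nf t n e₁ nl s l e₂ i n≤nl hₑ h = begin
  nfˢ (R (cons t n e₁) (suc nl)) ⊚ nfˢ (R (cons s l e₂) j)
    ≡⟨ cong₂ _⊚_ (nfˢ-R-cons t n e₁ (suc nl)) (nfˢ-R-cons s l e₂ j) ⟩
  (σ ⊚ ↑ⁿ (suc nl ∸ n)) ⊚ (nf (S s) ⟦ ↑ⁿ (j ∸ l) ⟧ ∷ τ)
    ≡⟨ ⊚-assoc σ _ _ ⟩
  σ ⊚ drop (suc nl ∸ n) (nf (S s) ⟦ ↑ⁿ (j ∸ l) ⟧ ∷ τ)
    ≡⟨ cong (λ m → σ ⊚ drop m (nf (S s) ⟦ ↑ⁿ (j ∸ l) ⟧ ∷ τ)) (+-∸-assoc 1 n≤nl) ⟩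
  σ ⊚ drop (nl ∸ n) τ
    ≡⟨ cong (λ ρ → σ ⊚ drop (nl ∸ n) ρ) (sym (nfˢ-R-weaken e₂ hₑ (m+n≤o⇒m≤o∸n l h))) ⟩
  σ ⊚ drop (nl ∸ n) (nfˢ (R e₂ j))
    ≡⟨ sym (⊚-assoc σ (↑ⁿ (nl ∸ n)) (nfˢ (R e₂ j))) ⟩
  (σ ⊚ ↑ⁿ (nl ∸ n)) ⊚ nfˢ (R e₂ j)
    ≡⟨ cong (_⊚ nfˢ (R e₂ j)) (sym (nfˢ-R-cons t n e₁ nl)) ⟩
  nfˢ (R (cons t n e₁) nl) ⊚ nfˢ (R e₂ j) ∎
  where j = i ∸ (nl ∸ len e₂)
        σ = nf (S t) ∷ nfˢ (R e₁ n)
        τ = nfˢ (R e₂ l) ⊚ ↑ⁿ (j ∸ l)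

m6-nf : ∀ t n e₁ ol₂ s l e₂ i → l + (n ∸ ol₂) ≤ i →
        nfˢ (R (comp (cons t n e₁) n ol₂ (cons s l e₂)) i) ≡
        nfˢ (R (cons (susp t ol₂ l (cons s l e₂)) (l + (n ∸ ol₂)) (comp e₁ n ol₂ (cons s l e₂))) i)
m6-nf t n e₁ ol₂ s l e₂ i h = begin
  nfˢ (R (cons t n e₁) n) ⊚ nfˢ (R c j)
    ≡⟨ cong (_⊚ nfˢ (R c j)) (nfˢ-R-cons t n e₁ n) ⟩
  (σ ⊚ ↑ⁿ (n ∸ n)) ⊚ nfˢ (R c j)
    ≡⟨ cong (λ m → (σ ⊚ ↑ⁿ m) ⊚ nfˢ (R c j)) (n∸n≡0 n) ⟩
  (σ ⊚ ↑ⁿ 0) ⊚ nfˢ (R c j)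
    ≡⟨ cong (_⊚ nfˢ (R c j)) (⊚-identityʳ σ) ⟩
  σ ⊚ nfˢ (R c j)
    ≡⟨ cong (σ ⊚_) (nfˢ-R-weaken c ≤-refl (m+n≤o⇒m≤o∸n l h)) ⟩
  σ ⊚ (nfˢ (R c l) ⊚ ↑ⁿ (j ∸ l))
    ≡⟨ cong (λ m → σ ⊚ (nfˢ (R c l) ⊚ ↑ⁿ m)) (trans (∸-+-assoc i x l) (cong (i ∸_) (+-comm x l))) ⟩
  σ ⊚ (nfˢ (R c l) ⊚ ↑ⁿ (i ∸ (l + x)))
    ≡⟨ sym (⊚-assoc σ (nfˢ (R c l)) (↑ⁿ (i ∸ (l + x)))) ⟩
  (nf (S t) ⟦ nfˢ (R c l) ⟧ ∷ nfˢ (R e₁ n) ⊚ nfˢ (R c l)) ⊚ ↑ⁿ (i ∸ (l + x))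
    ≡⟨ cong (λ m → (nf (S t) ⟦ nfˢ (R c l) ⟧ ∷ nfˢ (R e₁ n) ⊚ nfˢ (R c m)) ⊚ ↑ⁿ (i ∸ (l + x)))
            (sym (m+n∸n≡m l x)) ⟩
  (nf (S (susp t ol₂ l c)) ∷ nfˢ (R (comp e₁ n ol₂ c) (l + x))) ⊚ ↑ⁿ (i ∸ (l + x))
    ≡⟨ sym (nfˢ-R-cons (susp t ol₂ l c) (l + x) (comp e₁ n ol₂ c) i) ⟩
  nfˢ (R (cons (susp t ol₂ l c) (l + x) (comp e₁ n ol₂ c)) i) ∎
  where c = cons s l e₂
        x = n ∸ ol₂
        j = i ∸ x
        σ = nf (S t) ∷ nfˢ (R e₁ n)

shifts-step : ∀ {md s s′} k → md ⊢ s ⟶s s′ → md ⊢ shifts s k ⟶s shifts s′ k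
shifts-step zero r = r
shifts-step (suc k) r = comp₁ (shifts-step k r)

mutual
  simulateᵗ : ∀ {md u v} → WFTerm u → md ⊢ u ▷t v → Joinable (md ⊢_⟶t_) (S u) (S v)
  simulateᵗ _ βs = step-joinable Beta
  simulateᵗ _ (r2 {k = k} {nl = nl}) = nf-joinable _ _ (r2-nf k nl)
  simulateᵗ _ (r3 {ol = ol} {nl} {t} {l} {e}) = nf-joinable _ _ (r3-nf ol nl t l e)
  simulateᵗ (wf-susp _ (wf-cons _ _ hₑ) _ hₗ) (r4 {k = k} {ol} {nl} {t} {l} {e}) =
    nf-joinable _ _ (r4-nf k ol nl t l e hₑ hₗ)
  simulateᵗ _ r5 = step-joinable App
  simulateᵗ (wf-susp _ _ _ hₑ) (r6 {t = t} {ol} {nl} {e}) = nf-joinable _ _ (r6-nf t ol nl e hₑ)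
  simulateᵗ _ (m1 {t = t} {ol₁} {nl₁} {e₁} {ol₂} {nl₂} {e₂}) =
    nf-joinable _ _ (m1-nf t ol₁ nl₁ e₁ ol₂ nl₂ e₂)
  simulateᵗ (wf-app w _) (app₁ {u = b} r) = joinable-map (λ a → app a (S b)) app₁ (simulateᵗ w r)
  simulateᵗ (wf-app _ w) (app₂ {t = a} r) = joinable-map (app (S a)) app₂ (simulateᵗ w r)
  simulateᵗ (wf-lam w) (lam₁ r) = joinable-map lam lam₁ (simulateᵗ w r)
  simulateᵗ (wf-susp w _ _ _) (susp₁ {nl = nl} {e} r) =
    joinable-map (_[ R e nl ]) clo₁ (simulateᵗ w r)
  simulateᵗ (wf-susp _ w _ hₑ) (susp₂ {t = t} {nl = nl} r) =
    joinable-map (S t [_]) clo₂ (simulateˢ w r nl hₑ)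

  simulateˢ : ∀ {md u v} → WFEnv u → md ⊢ u ▷e v → ∀ i → lev u ≤ i →
              Joinable (md ⊢_⟶s_) (R u i) (R v i)
  simulateˢ (wf-comp _ _ h₁ _) (m2 {e₁ = e₁} {nl₁}) i h = nfˢ-joinable _ _ (m2-nf e₁ nl₁ i h₁ h)
  simulateˢ _ (m3 {ol₂ = ol₂} {e₂}) i _ = nfˢ-joinable _ _ (m3-nf ol₂ e₂ i)
  simulateˢ (wf-comp _ (wf-cons _ _ hₑ) _ refl) (m4 {nl₁ = suc n} {t = t} {l} {e₂} (s≤s z≤n)) i h =
    nfˢ-joinable _ _ (m4-nf n t l e₂ i hₑ h)
  simulateˢ (wf-comp _ (wf-cons _ _ hₑ) _ refl)
            (m5 {t = t} {n} {e₁} {suc nl} {s = s} {l} {e₂} (s≤s n≤nl)) i h =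
    nfˢ-joinable _ _ (m5-nf t n e₁ nl s l e₂ i n≤nl hₑ h)
  simulateˢ _ (m6 {t = t} {n} {e₁} {ol₂} {s} {l} {e₂}) i h = nfˢ-joinable _ _ (m6-nf t n e₁ ol₂ s l e₂ i h)
  simulateˢ (wf-cons w _ _) (cons₁ {l = l} {e} r) i _ =
    joinable-map (λ a → shifts (a · R e l) (i ∸ l)) (λ r → shifts-step (i ∸ l) (cons₁ r)) (simulateᵗ w r)
  simulateˢ (wf-cons _ w hₑ) (cons₂ {t = t} {l} r) i _ =
    joinable-map (λ s → shifts (S t · s) (i ∸ l)) (λ r → shifts-step (i ∸ l) (cons₂ r)) (simulateˢ w r l hₑ)
  simulateˢ (wf-comp w _ h₁ _) (comp₁ {nl₁ = nl₁} {ol₂} {e₂} r) i _ =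
    joinable-map (_∘ R e₂ (i ∸ (nl₁ ∸ ol₂))) comp₁ (simulateˢ w r nl₁ h₁)
  simulateˢ (wf-comp _ w _ _) (comp₂ {e₁ = e₁} {nl₁} {ol₂} {e₂} r) i h =
    joinable-map (R e₁ nl₁ ∘_) comp₂ (simulateˢ w r (i ∸ (nl₁ ∸ ol₂)) (m+n≤o⇒m≤o∸n (lev e₂) h))

theorem4p8 : (md : Mode) →
    ((u v : STerm) → WFTerm u → WFTerm v → md ⊢ u ▷t v →
      Σ LTerm (λ w → (md ⊢ S u ⟶t* w) × (md ⊢ S v ⟶t* w)))
    ×
    ((u v : Env) → WFEnv u → WFEnv v → md ⊢ u ▷e v →
      (i : ℕ) → lev u ≤ i →
      Σ Subst (λ w → (md ⊢ R u i ⟶s* w) × (md ⊢ R v i ⟶s* w)))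
theorem4p8 md = (λ _ _ wf-u _ r → simulateᵗ wf-u r) , (λ _ _ wf-u _ r → simulateˢ wf-u r)
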